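{- Let $(W,S)$ be a finite Coxeter system. The assignment $\langle\Lambda_I(W),\Lambda_J(W)\rangle:=c_{IJ}=\#\{w\in W:D(w^{ -1})=I,\ D(w)=J\}$ ($I,J\subseteq S$) extends to a well-defined bilinear form on $\Lambda(W)$, which is symmetric and nondegenerate. With this form, the inclusion $\imath:\Lambda(W)\hookrightarrow\Sigma^*(W)$ and the surjection $\chi':\Sigma(W)\twoheadrightarrow\Lambda(W)$ are dual to each other, i.e. $\langle\chi'(a),\lambda\rangle=\langle a,\imath(\lambda)\rangle$ for all $a\in\Sigma(W)$, $\lambda\in\Lambda(W)$ (right side: natural pairing of $\Sigma(W)$ and $\Sigma^*(W)$).
   Context: $D(w)=\{s\in S:\ell(ws)<\ell(w)\}$. $D_K(W)=\sum_{w\in W,\,D(w)=K}w\in\mathbb ZW$; $\Sigma(W)$ is the free $\mathbb Z$-module with basis $\{D_K(W):K\subseteq S\}$; $\Sigma^*(W)$ is its dual with dual basis $\{D^*_K(W)\}$, and $D^*_w(W):=D^*_{D(w)}(W)$. The linear map $\chi':\mathbb ZW\to\Sigma^*(W)$ is $w\mapsto D^*_{w^{ -1}}(W)$; $\Lambda(W):=\chi'(\Sigma(W))$, spanned by $\Lambda_I(W):=\chi'(D_I(W))=\sum_{w\in D_I(W)}D^*_{w^{ -1}}(W)$. -}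

module Defs where

open import Level using (Level; _⊔_) renaming (suc to lsuc)
open import Algebra.Bundles using (Group)
open import Data.Nat as ℕ using (ℕ; zero; suc; _≤_; _<_; _<?_)
open import Data.Fin using (Fin)
open import Data.Bool using (Bool; true; false; if_then_else_)
import Data.Bool as Bool
open import Data.Vec using (Vec; []; _∷_; tabulate)
open import Data.Vec.Properties using (≡-dec)
open import Data.List as List using (List; []; _∷_; _++_; map; foldr)
open import Data.List.Relation.Unary.Any using (Any)
open import Data.List.Relation.Unary.AllPairs using (AllPairs)
open import Data.Integer as ℤ using (ℤ; 0ℤ; 1ℤ)
open import Data.Product using (Σ; ∃; _×_; _,_; proj₁)
open import Relation.Nullary using (¬_; does)
open import Relation.Binary.PropositionalEquality using (_≡_; refl)
open import Relation.Binary.Definitions using (DecidableEquality)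

module _ {c ℓ : Level} (G : Group c ℓ) where
  open Group G

  pow : Carrier → ℕ → Carrier
  pow x zero    = ε
  pow x (suc k) = x ∙ pow x k

  IsOrder : Carrier → ℕ → Set ℓ
  IsOrder x m = (1 ≤ m) × (pow x m ≈ ε)
              × (∀ k → 1 ≤ k → k < m → ¬ (pow x k ≈ ε))

module _ {c₁ ℓ₁ c₂ ℓ₂ : Level} (G : Group c₁ ℓ₁) (H : Group c₂ ℓ₂) where
  private
    module G = Group G
    module H = Group H

  IsGroupHom : (G.Carrier → H.Carrier) → Set (c₁ ⊔ ℓ₁ ⊔ ℓ₂)
  IsGroupHom φ = (∀ {x y} → x G.≈ y → φ x H.≈ φ y)
               × (∀ x y → φ (x G.∙ y) H.≈ (φ x H.∙ φ y))

module _ {c ℓ : Level} (W : Group c ℓ) {n : ℕ} (s : Fin n → Group.Carrier W) where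
  open Group W hiding (refl)

  wordProd : List (Fin n) → Carrier
  wordProd = foldr (λ i x → s i ∙ x) ε

  record IsFiniteCoxeterSystem : Set (lsuc (c ⊔ ℓ)) where
    field
      gen-inv     : ∀ i → (s i ∙ s i) ≈ ε
      gen-nontriv : ∀ i → ¬ (s i ≈ ε)
      gen-inj     : ∀ i j → s i ≈ s j → i ≡ j
      -- Coxeter presentation W = ⟨ S | (s_i s_j)^{m_ij} ⟩, m_ij = order of s_i s_j,
      -- expressed by its universal property (uniqueness of the extension is
      -- automatic since S generates W, see len-word).
      presentation :
        (G : Group c ℓ) (f : Fin n → Group.Carrier G) →
        (∀ i j m → IsOrder W (s i ∙ s j) m →
           Group._≈_ G (pow G (Group._∙_ G (f i) (f j)) m) (Group.ε G)) →
        Σ (Carrier → Group.Carrier G) λ φ →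
          IsGroupHom W G φ × (∀ i → Group._≈_ G (φ (s i)) (f i))
      -- finiteness: an enumeration of W listing each element exactly once
      enum          : List Carrier
      enum-complete : ∀ w → Any (w ≈_) enum
      enum-distinct : AllPairs (λ x y → ¬ (x ≈ y)) enum
      -- the length function ℓ(w) w.r.t. S: the minimal length of a word in S
      -- representing w (S generates W, so such a word exists)
      len      : Carrier → ℕ
      len-word : ∀ w → Σ (List (Fin n)) λ ws → (List.length ws ≡ len w) × (wordProd ws ≈ w)
      len-min  : ∀ w (ws : List (Fin n)) → wordProd ws ≈ w → len w ≤ List.length ws

Subset : ℕ → Set
Subset n = Vec Bool n

_≟ₛ_ : ∀ {n} → DecidableEquality (Subset n)
_≟ₛ_ = ≡-dec Bool._≟_

allSubsets : (n : ℕ) → List (Subset n)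
allSubsets zero    = [] ∷ []
allSubsets (suc n) = map (true ∷_) (allSubsets n) ++ map (false ∷_) (allSubsets n)

sumℤ : List ℤ → ℤ
sumℤ = foldr ℤ._+_ 0ℤ

[_≐_] : ∀ {n} → Subset n → Subset n → ℤ
[ K ≐ L ] = if does (K ≟ₛ L) then 1ℤ else 0ℤ

module CoxeterTheory {c ℓ : Level} {W : Group c ℓ} {n : ℕ}
                     {s : Fin n → Group.Carrier W}
                     (cox : IsFiniteCoxeterSystem W s) where
  open Group W hiding (refl)
  open IsFiniteCoxeterSystem cox

  D : Carrier → Subset n
  D w = tabulate (λ i → does (len (w ∙ s i) <? len w))

  -- ℤW, as coefficient functions on W (finitely supported since W is finite)
  ZW : Set c
  ZW = Carrier → ℤ

  -- Σ(W): free ℤ-module with basis D_K(W), K ⊆ S (coefficient vectors)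
  SigmaW : Set
  SigmaW = Subset n → ℤ

  -- Σ*(W): its dual, coordinates w.r.t. the dual basis D*_K(W)
  SigmaW* : Set
  SigmaW* = Subset n → ℤ

  basis : Subset n → SigmaW
  basis I K = [ I ≐ K ]

  -- the inclusion Σ(W) ⊆ ℤW :  Σ_K a_K D_K(W),  D_K(W) = Σ_{D(w)=K} w
  toZW : SigmaW → ZW
  toZW a w = sumℤ (map (λ K → a K ℤ.* [ D w ≐ K ]) (allSubsets n))

  -- χ' : ℤW → Σ*(W),  w ↦ D*_{w⁻¹}(W) = D*_{D(w⁻¹)}(W)
  χ' : ZW → SigmaW*
  χ' x K = sumℤ (map (λ w → x w ℤ.* [ D (w ⁻¹) ≐ K ]) enum)

  pair : SigmaW → SigmaW* → ℤ
  pair a f = sumℤ (map (λ K → a K ℤ.* f K) (allSubsets n))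

  -- Λ(W) = χ'(Σ(W)) ⊆ Σ*(W)
  InΛ : SigmaW* → Set
  InΛ v = Σ SigmaW λ a → ∀ K → χ' (toZW a) K ≡ v K

  ΛW : Set
  ΛW = Σ SigmaW* InΛ

  χΛ : SigmaW → ΛW
  χΛ a = χ' (toZW a) , a , λ K → refl

  Λ_ : Subset n → ΛW
  Λ_ I = χΛ (basis I)

  ı : ΛW → SigmaW*
  ı = proj₁

  cc : Subset n → Subset n → ℤ
  cc I J = sumℤ (map (λ w → [ D (w ⁻¹) ≐ I ] ℤ.* [ D w ≐ J ]) enum)

-- For a, b ∈ Σ(W), viewed as functions of descent sets, ⟨a, χ'(b)⟩ = Σ_{w ∈ W} a(D(w⁻¹)) b(D(w)),
-- which is symmetric in a and b because w ↦ w⁻¹ permutes W. Hence ⟨χ'(a), χ'(b)⟩ := ⟨a, χ'(b)⟩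
-- does not depend on the preimages chosen, is symmetric, and is bilinear because the natural
-- pairing is; on basis elements it counts c_IJ. Nondegeneracy: ⟨Λ_K, λ⟩ is the K-th coordinate of λ.
module Submission where

open import Defs
open import Level using (Level)
open import Algebra.Bundles using (Group)
open import Data.Nat using (ℕ)
open import Data.Fin using (Fin)
open import Data.Integer using (ℤ; 0ℤ; _+_; _*_)
open import Data.Product using (Σ; _×_; proj₁)
open import Relation.Binary.PropositionalEquality using (_≡_)

import Algebra.Properties.CommutativeSemigroup as CommSemigroupProperties
import Algebra.Properties.Group as GroupProperties
open import Data.Bool using (true; false)
open import Data.Empty using (⊥-elim)
open import Data.Integer.Properties
  using (+-assoc; +-identityˡ; +-identityʳ; *-identityʳ; *-zeroʳ; *-comm; *-distribˡ-+;
         +-0-isCommutativeMonoid; +-commutativeSemigroup; *-commutativeSemigroup)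
open import Data.List using (List; []; _∷_; _++_; map)
import Data.List.Membership.Setoid as Membership
open import Data.List.Membership.Setoid.Properties
  using (∈-resp-≈; ∈-map⁺; All[≉]⇒∉; ∉-resp-≈)
open import Data.List.Properties using (map-∘)
import Data.List.Relation.Binary.Permutation.Setoid as PermutationSetoid
import Data.List.Relation.Binary.Permutation.Setoid.Properties as Permutation
import Data.List.Relation.Binary.Subset.Setoid as SubsetSetoid
open import Data.List.Relation.Unary.All.Properties using (─⁺)
open import Data.List.Relation.Unary.AllPairs using (_∷_)
open import Data.List.Relation.Unary.Any using (here; there)
import Data.List.Relation.Unary.Unique.Setoid as UniqueSetoid
import Data.List.Relation.Unary.Unique.Setoid.Properties as Unique
open import Data.Nat using (zero; suc; _≤_; _<?_)
import Data.Nat.Properties as ℕ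
open import Data.Product using (_,_; proj₂)
open import Data.Vec using ([]; _∷_)
open import Data.Vec.Properties using (tabulate-cong)
open import Function using (_∘_)
open import Relation.Binary.Bundles using (Setoid)
open import Relation.Binary.PropositionalEquality
  using (refl; sym; trans; cong; cong₂; module ≡-Reasoning) renaming (setoid to ≡-setoid)
open import Relation.Nullary using (¬_; does)

open CommSemigroupProperties +-commutativeSemigroup using (interchange)
open CommSemigroupProperties *-commutativeSemigroup using (x∙yz≈y∙xz)

private
  variable
    a : Level
    A B : Set a

sumOver : (A → ℤ) → List A → ℤ
sumOver f xs = sumℤ (map f xs)

infix 10 sumOver
syntax sumOver (λ x → e) xs = ∑[ x ← xs ] e

module _ {f g : A → ℤ} where

  ∑-cong : (∀ x → f x ≡ g x) → ∀ xs → ∑[ x ← xs ] f x ≡ ∑[ x ← xs ] g x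
  ∑-cong f≗g []       = refl
  ∑-cong f≗g (x ∷ xs) = cong₂ _+_ (f≗g x) (∑-cong f≗g xs)

  ∑-distrib-+ : ∀ xs → ∑[ x ← xs ] (f x + g x) ≡ ∑[ x ← xs ] f x + ∑[ x ← xs ] g x
  ∑-distrib-+ []       = refl
  ∑-distrib-+ (x ∷ xs) = trans (cong (f x + g x +_) (∑-distrib-+ xs))
                               (interchange (f x) (g x) _ _)

∑-zero : {f : A → ℤ} → (∀ x → f x ≡ 0ℤ) → ∀ xs → ∑[ x ← xs ] f x ≡ 0ℤ
∑-zero f≡0 []       = refl
∑-zero f≡0 (x ∷ xs) = cong₂ _+_ (f≡0 x) (∑-zero f≡0 xs)

*-distribˡ-∑ : ∀ k (f : A → ℤ) xs → k * ∑[ x ← xs ] f x ≡ ∑[ x ← xs ] (k * f x)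
*-distribˡ-∑ k f []       = *-zeroʳ k
*-distribˡ-∑ k f (x ∷ xs) =
  trans (*-distribˡ-+ k (f x) _) (cong (k * f x +_) (*-distribˡ-∑ k f xs))

∑-++ : (f : A → ℤ) → ∀ xs ys → ∑[ x ← xs ++ ys ] f x ≡ ∑[ x ← xs ] f x + ∑[ x ← ys ] f x
∑-++ f []       ys = sym (+-identityˡ _)
∑-++ f (x ∷ xs) ys = trans (cong (f x +_) (∑-++ f xs ys)) (sym (+-assoc (f x) _ _))

∑-map : (f : B → ℤ) (g : A → B) → ∀ xs → ∑[ y ← map g xs ] f y ≡ ∑[ x ← xs ] f (g x)
∑-map f g xs = cong sumℤ (sym (map-∘ xs))

∑-comm : (f : A → B → ℤ) → ∀ xs ys →
         ∑[ x ← xs ] ∑[ y ← ys ] f x y ≡ ∑[ y ← ys ] ∑[ x ← xs ] f x y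
∑-comm f []       ys = sym (∑-zero (λ _ → refl) ys)
∑-comm f (x ∷ xs) ys = trans (cong (∑[ y ← ys ] f x y +_) (∑-comm f xs ys))
                             (sym (∑-distrib-+ ys))

module _ {c ℓ} (S : Setoid c ℓ) where
  open Setoid S using (_≈_) renaming (Carrier to X; refl to ≈-refl; sym to ≈-sym; trans to ≈-trans)
  open Membership S using (_∈_; _∉_; _─_)
  open UniqueSetoid S using (Unique)
  open SubsetSetoid S using (_⊆_)
  open PermutationSetoid S using (_↭_; prep; ↭-refl; ↭-prep; ↭-swap; ↭-trans)

  private
    variable
      x y : X
      xs ys : List X

  Unique-─ : (p : x ∈ xs) → Unique xs → Unique (xs ─ p)
  Unique-─ (here _)  (_ ∷ xs!)    = xs!
  Unique-─ (there p) (z∉ ∷ xs!)   = ─⁺ p z∉ ∷ Unique-─ p xs!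

  ─-⊆ : (p : x ∈ xs) → xs ─ p ⊆ xs
  ─-⊆ (here _)  q         = there q
  ─-⊆ (there p) (here e)  = here e
  ─-⊆ (there p) (there q) = there (─-⊆ p q)

  ∈-─ : (p : x ∈ xs) → y ∈ xs → ¬ y ≈ x → y ∈ xs ─ p
  ∈-─ (here x≈z) (here y≈z) y≉x = ⊥-elim (y≉x (≈-trans y≈z (≈-sym x≈z)))
  ∈-─ (here _)   (there q)  _   = q
  ∈-─ (there p)  (here y≈z) _   = here y≈z
  ∈-─ (there p)  (there q)  y≉x = there (∈-─ p q y≉x)

  ∉-─ : Unique xs → (p : x ∈ xs) → x ∉ xs ─ p
  ∉-─ (z∉ ∷ _)   (here x≈z) = ∉-resp-≈ S (≈-sym x≈z) (All[≉]⇒∉ S z∉)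
  ∉-─ (z∉ ∷ _)   (there p)  (here x≈z) = All[≉]⇒∉ S z∉ (∈-resp-≈ S x≈z p)
  ∉-─ (_ ∷ xs!)  (there p)  (there q)  = ∉-─ xs! p q

  ∷-─-↭ : (p : x ∈ xs) → x ∷ (xs ─ p) ↭ xs
  ∷-─-↭ (here x≈z)         = prep x≈z ↭-refl
  ∷-─-↭ {x} {z ∷ _} (there p) = ↭-trans (↭-swap x z ↭-refl) (↭-prep z (∷-─-↭ p))

  Unique-⊆-antisym⇒↭ : Unique xs → Unique ys → xs ⊆ ys → ys ⊆ xs → xs ↭ ys
  Unique-⊆-antisym⇒↭ {[]} {[]} _ _ _ _ = ↭-refl
  Unique-⊆-antisym⇒↭ {[]} {_ ∷ _} _ _ _ ys⊆xs with ys⊆xs (here ≈-refl)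
  ... | ()
  Unique-⊆-antisym⇒↭ {x ∷ xs} (x∉xs ∷ xs!) ys! xs⊆ys ys⊆xs =
    ↭-trans (↭-prep x (Unique-⊆-antisym⇒↭ xs! (Unique-─ p ys!) xs⊆ys─p ys─p⊆xs)) (∷-─-↭ p)
    where
    p : x ∈ _
    p = xs⊆ys (here ≈-refl)
    xs⊆ys─p : xs ⊆ _ ─ p
    xs⊆ys─p q = ∈-─ p (xs⊆ys (there q)) (λ z≈x → All[≉]⇒∉ S x∉xs (∈-resp-≈ S z≈x q))
    ys─p⊆xs : _ ─ p ⊆ xs
    ys─p⊆xs q with ys⊆xs (─-⊆ p q)
    ... | here z≈x = ⊥-elim (∉-─ ys! p (∈-resp-≈ S z≈x q))
    ... | there r  = r

  ∑-↭ : {f : X → ℤ} → (∀ {x y} → x ≈ y → f x ≡ f y) →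
        xs ↭ ys → ∑[ x ← xs ] f x ≡ ∑[ y ← ys ] f y
  ∑-↭ f-cong xs↭ys =
    Permutation.foldr-commMonoid (≡-setoid ℤ) +-0-isCommutativeMonoid
      (Permutation.map⁺ S (≡-setoid ℤ) f-cong xs↭ys)

module _ {c ℓ} (G : Group c ℓ) where
  open Group G using (Carrier; _≈_; _⁻¹; ⁻¹-cong; setoid)
  open GroupProperties G using (⁻¹-involutive; ⁻¹-injective)
  open Membership setoid using (_∈_)
  open UniqueSetoid setoid using (Unique)

  ∑-⁻¹ : {f : Carrier → ℤ} → (∀ {x y} → x ≈ y → f x ≡ f y) →
         ∀ {ws} → Unique ws → (∀ w → w ∈ ws) → ∑[ w ← ws ] f (w ⁻¹) ≡ ∑[ w ← ws ] f w
  ∑-⁻¹ {f} f-cong {ws} ws! ws-complete =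
    trans (sym (∑-map f _⁻¹ ws))
          (∑-↭ setoid f-cong (Unique-⊆-antisym⇒↭ setoid
            (Unique.map⁺ setoid setoid ⁻¹-injective ws!) ws! (λ _ → ws-complete _) ws⊆ws⁻¹))
    where
    ws⊆ws⁻¹ : ∀ {w} → w ∈ ws → w ∈ map _⁻¹ ws
    ws⊆ws⁻¹ {w} _ = ∈-resp-≈ setoid (⁻¹-involutive w)
                      (∈-map⁺ setoid setoid ⁻¹-cong (ws-complete (w ⁻¹)))

-- [ x ∷ K ≐ y ∷ L ] computes to [ K ≐ L ] when x and y agree, and to 0ℤ otherwise.
≐-sym : ∀ {n} (K L : Subset n) → [ K ≐ L ] ≡ [ L ≐ K ]
≐-sym []          []          = refl
≐-sym (true ∷ K)  (true ∷ L)  = ≐-sym K L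
≐-sym (true ∷ K)  (false ∷ L) = refl
≐-sym (false ∷ K) (true ∷ L)  = refl
≐-sym (false ∷ K) (false ∷ L) = ≐-sym K L

∑-allSubsets-suc : ∀ n (f : Subset (suc n) → ℤ) →
  ∑[ L ← allSubsets (suc n) ] f L
    ≡ ∑[ L ← allSubsets n ] f (true ∷ L) + ∑[ L ← allSubsets n ] f (false ∷ L)
∑-allSubsets-suc n f =
  trans (∑-++ f (map (true ∷_) Ls) (map (false ∷_) Ls))
        (cong₂ _+_ (∑-map f (true ∷_) Ls) (∑-map f (false ∷_) Ls))
  where Ls = allSubsets n

∑-select : ∀ n (f : Subset n → ℤ) K → ∑[ L ← allSubsets n ] (f L * [ K ≐ L ]) ≡ f K
∑-select zero f [] = trans (+-identityʳ _) (*-identityʳ (f []))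
∑-select (suc n) f (true ∷ K) =
  trans (∑-allSubsets-suc n _)
        (trans (cong₂ _+_ (∑-select n (f ∘ (true ∷_)) K)
                          (∑-zero (λ L → *-zeroʳ (f (false ∷ L))) (allSubsets n)))
               (+-identityʳ _))
∑-select (suc n) f (false ∷ K) =
  trans (∑-allSubsets-suc n _)
        (trans (cong₂ _+_ (∑-zero (λ L → *-zeroʳ (f (true ∷ L))) (allSubsets n))
                          (∑-select n (f ∘ (false ∷_)) K))
               (+-identityˡ _))

module DescentForm {c ℓ} {W : Group c ℓ} {n} {s : Fin n → Group.Carrier W}
                   (cox : IsFiniteCoxeterSystem W s) where
  open Group W using (_≈_; _⁻¹; ∙-congʳ; ⁻¹-cong)
    renaming (sym to ≈-sym; trans to ≈-trans)
  open GroupProperties W using (⁻¹-involutive)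
  open IsFiniteCoxeterSystem cox
  open CoxeterTheory cox
  open ≡-Reasoning

  private
    Ks = allSubsets n

  len-cong : ∀ {w w′} → w ≈ w′ → len w ≡ len w′
  len-cong {w} {w′} w≈w′ = ℕ.≤-antisym (len-≤ (≈-sym w≈w′)) (len-≤ w≈w′)
    where
    len-≤ : ∀ {u v} → u ≈ v → len v ≤ len u
    len-≤ {u} {v} u≈v with len-word u
    ... | us , |us|≡len , us≈u = ℕ.≤-trans (len-min v us (≈-trans us≈u u≈v)) (ℕ.≤-reflexive |us|≡len)

  D-cong : ∀ {w w′} → w ≈ w′ → D w ≡ D w′
  D-cong w≈w′ = tabulate-cong λ i →
    cong₂ (λ l l′ → does (l <? l′)) (len-cong (∙-congʳ w≈w′)) (len-cong w≈w′)

  toZW-D : ∀ a w → toZW a w ≡ a (D w)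
  toZW-D a w = ∑-select n a (D w)

  pair-χ' : ∀ a x → pair a (χ' x) ≡ ∑[ w ← enum ] (x w * a (D (w ⁻¹)))
  pair-χ' a x = begin
    ∑[ K ← Ks ] (a K * ∑[ w ← enum ] (x w * [ D (w ⁻¹) ≐ K ]))
      ≡⟨ ∑-cong (λ K → *-distribˡ-∑ (a K) _ enum) Ks ⟩
    ∑[ K ← Ks ] ∑[ w ← enum ] (a K * (x w * [ D (w ⁻¹) ≐ K ]))
      ≡⟨ ∑-comm _ Ks enum ⟩
    ∑[ w ← enum ] ∑[ K ← Ks ] (a K * (x w * [ D (w ⁻¹) ≐ K ]))
      ≡⟨ ∑-cong select enum ⟩
    ∑[ w ← enum ] (x w * a (D (w ⁻¹)))
      ∎
    where
    select : ∀ w → ∑[ K ← Ks ] (a K * (x w * [ D (w ⁻¹) ≐ K ])) ≡ x w * a (D (w ⁻¹))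
    select w = begin
      ∑[ K ← Ks ] (a K * (x w * [ D (w ⁻¹) ≐ K ]))
        ≡⟨ ∑-cong (λ K → x∙yz≈y∙xz (a K) (x w) _) Ks ⟩
      ∑[ K ← Ks ] (x w * (a K * [ D (w ⁻¹) ≐ K ]))
        ≡⟨ *-distribˡ-∑ (x w) _ Ks ⟨
      x w * ∑[ K ← Ks ] (a K * [ D (w ⁻¹) ≐ K ])
        ≡⟨ cong (x w *_) (∑-select n a (D (w ⁻¹))) ⟩
      x w * a (D (w ⁻¹))
        ∎

  pair-χΛ : ∀ a b → pair a (ı (χΛ b)) ≡ ∑[ w ← enum ] (b (D w) * a (D (w ⁻¹)))
  pair-χΛ a b = trans (pair-χ' a (toZW b)) (∑-cong (λ w → cong (_* _) (toZW-D b w)) enum)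

  pair-χΛ-sym : ∀ a b → pair a (ı (χΛ b)) ≡ pair b (ı (χΛ a))
  pair-χΛ-sym a b = begin
    pair a (ı (χΛ b))
      ≡⟨ pair-χΛ a b ⟩
    ∑[ w ← enum ] (b (D w) * a (D (w ⁻¹)))
      ≡⟨ ∑-cong (λ w → trans (*-comm (b (D w)) _) (cong (λ K → a (D (w ⁻¹)) * b K)
                                                 (D-cong (≈-sym (⁻¹-involutive w))))) enum ⟩
    ∑[ w ← enum ] (a (D (w ⁻¹)) * b (D (w ⁻¹ ⁻¹)))
      ≡⟨ ∑-⁻¹ W (λ u≈v → cong₂ _*_ (cong a (D-cong u≈v)) (cong b (D-cong (⁻¹-cong u≈v))))
              enum-distinct enum-complete ⟩
    ∑[ w ← enum ] (a (D w) * b (D (w ⁻¹)))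
      ≡⟨ pair-χΛ b a ⟨
    pair b (ı (χΛ a))
      ∎

  pair-basisˡ : ∀ K f → pair (basis K) f ≡ f K
  pair-basisˡ K f = trans (∑-cong (λ L → *-comm [ K ≐ L ] (f L)) Ks) (∑-select n f K)

  pair-+ʳ : ∀ a {f g h} → (∀ K → h K ≡ f K + g K) → pair a h ≡ pair a f + pair a g
  pair-+ʳ a h≡f+g =
    trans (∑-cong (λ K → trans (cong (a K *_) (h≡f+g K)) (*-distribˡ-+ (a K) _ _)) Ks)
          (∑-distrib-+ Ks)

  pair-*ʳ : ∀ a k {f h} → (∀ K → h K ≡ k * f K) → pair a h ≡ k * pair a f
  pair-*ʳ a k h≡kf =
    trans (∑-cong (λ K → trans (cong (a K *_) (h≡kf K)) (x∙yz≈y∙xz (a K) k _)) Ks)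
          (sym (*-distribˡ-∑ k _ Ks))

  preimage : ΛW → SigmaW
  preimage = proj₁ ∘ proj₂

  -- ⟨ χ'(a) , λ ⟩ := ⟨ a , ı λ ⟩; independence of the preimage a is ⟨⟩-sym.
  ⟨_,_⟩ : ΛW → ΛW → ℤ
  ⟨ x , y ⟩ = pair (preimage x) (ı y)

  ⟨⟩-pair-χΛ : ∀ x y → ⟨ x , y ⟩ ≡ pair (preimage x) (ı (χΛ (preimage y)))
  ⟨⟩-pair-χΛ x y = ∑-cong (λ K → cong (preimage x K *_) (sym (proj₂ (proj₂ y) K))) Ks

  ⟨⟩-sym : ∀ x y → ⟨ x , y ⟩ ≡ ⟨ y , x ⟩
  ⟨⟩-sym x y = begin
    ⟨ x , y ⟩                                  ≡⟨ ⟨⟩-pair-χΛ x y ⟩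
    pair (preimage x) (ı (χΛ (preimage y)))   ≡⟨ pair-χΛ-sym (preimage x) (preimage y) ⟩
    pair (preimage y) (ı (χΛ (preimage x)))   ≡⟨ ⟨⟩-pair-χΛ y x ⟨
    ⟨ y , x ⟩                                  ∎

  ⟨⟩-+ʳ : ∀ w x y z → (∀ K → ı z K ≡ ı x K + ı y K) → ⟨ w , z ⟩ ≡ ⟨ w , x ⟩ + ⟨ w , y ⟩
  ⟨⟩-+ʳ w x y z = pair-+ʳ (preimage w)

  ⟨⟩-*ʳ : ∀ k w x z → (∀ K → ı z K ≡ k * ı x K) → ⟨ w , z ⟩ ≡ k * ⟨ w , x ⟩
  ⟨⟩-*ʳ k w x z = pair-*ʳ (preimage w) k

  ⟨⟩-+ˡ : ∀ x y z w → (∀ K → ı z K ≡ ı x K + ı y K) → ⟨ z , w ⟩ ≡ ⟨ x , w ⟩ + ⟨ y , w ⟩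
  ⟨⟩-+ˡ x y z w z≡x+y =
    trans (⟨⟩-sym z w) (trans (⟨⟩-+ʳ w x y z z≡x+y) (cong₂ _+_ (⟨⟩-sym w x) (⟨⟩-sym w y)))

  ⟨⟩-*ˡ : ∀ k x z w → (∀ K → ı z K ≡ k * ı x K) → ⟨ z , w ⟩ ≡ k * ⟨ x , w ⟩
  ⟨⟩-*ˡ k x z w z≡kx =
    trans (⟨⟩-sym z w) (trans (⟨⟩-*ʳ k w x z z≡kx) (cong (k *_) (⟨⟩-sym w x)))

  ⟨Λ,Λ⟩≡cc : ∀ I J → ⟨ Λ_ I , Λ_ J ⟩ ≡ cc I J
  ⟨Λ,Λ⟩≡cc I J = trans (pair-χΛ (basis I) (basis J)) (∑-cong swap enum)
    where
    swap : ∀ w → [ J ≐ D w ] * [ I ≐ D (w ⁻¹) ] ≡ [ D (w ⁻¹) ≐ I ] * [ D w ≐ J ]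
    swap w = trans (*-comm [ J ≐ D w ] _) (cong₂ _*_ (≐-sym I (D (w ⁻¹))) (≐-sym J (D w)))

  ⟨⟩-nondegenerate : ∀ x → (∀ y → ⟨ x , y ⟩ ≡ 0ℤ) → ∀ K → ı x K ≡ 0ℤ
  ⟨⟩-nondegenerate x x⊥ K = begin
    ı x K              ≡⟨ pair-basisˡ K (ı x) ⟨
    ⟨ Λ_ K , x ⟩       ≡⟨ ⟨⟩-sym (Λ_ K) x ⟩
    ⟨ x , Λ_ K ⟩       ≡⟨ x⊥ (Λ_ K) ⟩
    0ℤ                 ∎

proposition2p15 :
    ∀ {c ℓ : Level} (W : Group c ℓ) (n : ℕ) (s : Fin n → Group.Carrier W)
      (cox : IsFiniteCoxeterSystem W s) →
    let open CoxeterTheory cox in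
    Σ (ΛW → ΛW → ℤ) λ B →
      (∀ x y z w → (∀ K → ı z K ≡ ı x K + ı y K) → B z w ≡ B x w + B y w)
      × (∀ (k : ℤ) x z w → (∀ K → ı z K ≡ k * ı x K) → B z w ≡ k * B x w)
      × (∀ w x y z → (∀ K → ı z K ≡ ı x K + ı y K) → B w z ≡ B w x + B w y)
      × (∀ (k : ℤ) w x z → (∀ K → ı z K ≡ k * ı x K) → B w z ≡ k * B w x)
      × (∀ I J → B (Λ_ I) (Λ_ J) ≡ cc I J)
      × (∀ x y → B x y ≡ B y x)
      × (∀ x → (∀ y → B x y ≡ 0ℤ) → ∀ K → ı x K ≡ 0ℤ)
      × (∀ a y → B (χΛ a) y ≡ pair a (ı y))
proposition2p15 W n s cox =
  ⟨_,_⟩ , ⟨⟩-+ˡ , ⟨⟩-*ˡ , ⟨⟩-+ʳ , ⟨⟩-*ʳ , ⟨Λ,Λ⟩≡cc , ⟨⟩-sym , ⟨⟩-nondegenerate , λ a y → refl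
  where open DescentForm cox
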